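{- Let $P,Q\in\mathcal{D}_n$ and fix a trajectory of a light beam in the grid polygon associated with $(P,Q)$, oriented in one of its two directions of travel. Let $\ell_1,\ell_2$ be two segments of light of this trajectory. (i) If $\ell_1,\ell_2$ lie on the lines $y=x+\frac{4k+1}{2}$ and $y=x+\frac{4k+3}{2}$, respectively, for some integer $k$, then $\ell_1$ and $\ell_2$ move in opposite directions (one northeast, the other southwest). (ii) If $\ell_1,\ell_2$ lie on the lines $y=-x+\frac{4k+1}{2}$ and $y=-x+\frac{4k+3}{2}$, respectively, for some integer $k$, then $\ell_1$ and $\ell_2$ move in opposite directions (one northwest, the other southeast).
   Context: A Dyck path of size $n$ is a lattice path in $\mathbb{Z}^2$ from $(0,0)$ to $(n,n)$ using steps $\mathsf{N}=(0,1)$ and $\mathsf{E}=(1,0)$ that never goes below $y=x$; $\mathcal{D}_n$ is the set of such paths. For a Dyck path $P$, $-P$ is its reflection over $y=x$. For $P,Q\in\mathcal{D}_n$, the grid polygon associated with $(P,Q)$ is the region enclosed by $P$ and $-Q$; its boundary consists of the $4n$ unit steps of $P$ and $-Q$. From the midpoint of any boundary step, a light beam is emitted into the interior making a $45^\circ$ angle with that step; it travels straight until it reaches the midpoint of another boundary step (meeting it at $45^\circ$), where it reflects and continues. A trajectory is a closed path of the light obtained in this way (a cycle of the resulting permutation of boundary steps); it is a union of straight segments of light joining midpoints of boundary steps, each lying on a line of slope $1$ or $-1$. -}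

module Defs where

open import Data.Nat using (ℕ; zero; suc; _<_)
open import Data.Integer using (ℤ; +_; _+_; _-_; _*_)
open import Data.List using (List; []; _∷_; map)
open import Data.List.Membership.Propositional using (_∈_)
open import Data.Product using (_×_; _,_)
open import Data.Sum using (_⊎_)
open import Relation.Binary.PropositionalEquality using (_≡_)
open import Relation.Nullary using (¬_)

data Step : Set where
  N E : Step

-- DyckFrom n x y s : the step word s, started at lattice point (x , y),
-- never goes below y = x (every point visited has x ≤ y) and ends at (n , n).
data DyckFrom (n : ℕ) : ℕ → ℕ → List Step → Set where
  done  : DyckFrom n n n []
  north : ∀ {x y s} → DyckFrom n x (suc y) s → DyckFrom n x y (N ∷ s)
  east  : ∀ {x y s} → x < y → DyckFrom n (suc x) y s → DyckFrom n x y (E ∷ s)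

Dyck : ℕ → List Step → Set
Dyck n P = DyckFrom n 0 0 P

data Edge : Set where
  horiz : ℤ → ℤ → Edge   -- the unit step from (i , j) to (i+1 , j)
  vert  : ℤ → ℤ → Edge   -- the unit step from (i , j) to (i , j+1)

stepsFrom : ℤ → ℤ → List Step → List Edge
stepsFrom x y []      = []
stepsFrom x y (N ∷ s) = vert x y  ∷ stepsFrom x (y + + 1) s
stepsFrom x y (E ∷ s) = horiz x y ∷ stepsFrom (x + + 1) y s

steps : List Step → List Edge
steps P = stepsFrom (+ 0) (+ 0) P

reflectEdge : Edge → Edge
reflectEdge (horiz i j) = vert j i
reflectEdge (vert i j)  = horiz j i

negSteps : List Step → List Edge
negSteps Q = map reflectEdge (steps Q)

Boundary : List Step → List Step → Edge → Set
Boundary P Q e = e ∈ steps P ⊎ e ∈ negSteps Q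

data Dir : Set where
  NE NW SE SW : Dir

-- Midpoint of an edge, in doubled coordinates (X , Y) = (2x , 2y).
mid : Edge → ℤ × ℤ
mid (horiz i j) = (+ 2 * i + + 1 , + 2 * j)
mid (vert i j)  = (+ 2 * i , + 2 * j + + 1)

-- Moving from the midpoint of edge e in direction d by the vector
-- (±1/2 , ±1/2) (i.e. (±1,±1) in doubled coordinates), straight across one
-- unit cell, one reaches the midpoint of the edge  adv e d.
adv : Edge → Dir → Edge
adv (horiz i j) NE = vert (i + + 1) j
adv (horiz i j) NW = vert i j
adv (horiz i j) SE = vert (i + + 1) (j - + 1)
adv (horiz i j) SW = vert i (j - + 1)
adv (vert i j)  NE = horiz i (j + + 1)
adv (vert i j)  NW = horiz (i - + 1) (j + + 1)
adv (vert i j)  SE = horiz i j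
adv (vert i j)  SW = horiz (i - + 1) j

-- Law of reflection at an edge (the light meets it at 45°):
-- a horizontal edge flips the vertical component, a vertical edge the
-- horizontal one.
reflectDir : Edge → Dir → Dir
reflectDir (horiz _ _) NE = SE
reflectDir (horiz _ _) SE = NE
reflectDir (horiz _ _) NW = SW
reflectDir (horiz _ _) SW = NW
reflectDir (vert _ _)  NE = NW
reflectDir (vert _ _)  NW = NE
reflectDir (vert _ _)  SE = SW
reflectDir (vert _ _)  SW = SE

-- Travel P Q e d e' : light leaving the midpoint of e in direction d travels
-- straight (through midpoints of non-boundary edges) and the first boundary
-- step whose midpoint it reaches is e'.
data Travel (P Q : List Step) : Edge → Dir → Edge → Set where
  hit  : ∀ {e d} → Boundary P Q (adv e d) → Travel P Q e d (adv e d)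
  pass : ∀ {e d e'} → ¬ Boundary P Q (adv e d) →
         Travel P Q (adv e d) d e' → Travel P Q e d e'

-- P runs from (0,0) to (n,n) with the polygon on its right
-- (south-east) side; -Q with the polygon on its left (north-west) side.
IntoFromP : Edge → Dir → Set
IntoFromP (horiz _ _) d = d ≡ SE ⊎ d ≡ SW
IntoFromP (vert _ _)  d = d ≡ NE ⊎ d ≡ SE

IntoFromNegQ : Edge → Dir → Set
IntoFromNegQ (horiz _ _) d = d ≡ NE ⊎ d ≡ NW
IntoFromNegQ (vert _ _)  d = d ≡ NW ⊎ d ≡ SW

-- A segment of light (with its direction of travel) is determined by its
-- starting boundary step e and its direction d.
Emits : List Step → List Step → Edge → Dir → Set
Emits P Q e d = (e ∈ steps P × IntoFromP e d) ⊎ (e ∈ negSteps Q × IntoFromNegQ e d)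

Next : List Step → List Step → Edge × Dir → Edge × Dir → Set
Next P Q (e , d) (e' , d') = Travel P Q e d e' × d' ≡ reflectDir e' d

-- The segment (e , d) lies on the line y = x + c/2
-- (i.e. it has slope 1 and its points satisfy 2y - 2x = c).
OnDiagLine : Edge → Dir → ℤ → Set
OnDiagLine e d c with mid e
... | (X , Y) = (d ≡ NE ⊎ d ≡ SW) × Y - X ≡ c

-- The segment (e , d) lies on the line y = -x + c/2
-- (i.e. it has slope -1 and its points satisfy 2y + 2x = c).
OnAntiLine : Edge → Dir → ℤ → Set
OnAntiLine e d c with mid e
... | (X , Y) = (d ≡ NW ⊎ d ≡ SE) × Y + X ≡ c

{-# OPTIONS --safe #-}

-- In doubled coordinates a segment of light leaves a midpoint m with velocity
-- v = (±1, ±1).  The Minkowski product ⟨m, v⟩ = m_y v_y − m_x v_x is constant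
-- along the segment because v is lightlike, and a reflection changes it by a
-- multiple of 4: it negates the velocity component normal to the edge, and the
-- matching coordinate of the midpoint is even.  So ⟨m, v⟩ mod 4 is an invariant
-- of the oriented trajectory.  On the line y = ±x + c/2 it is c or −c according
-- to the direction of travel, and 4k+1 ≢ 4k+3, −(4k+1) ≢ −(4k+3) (mod 4).

module Submission where

open import Defs
open import Data.Nat using (ℕ; s≤s)
open import Data.Nat.Divisibility using (∣⇒≤)
open import Data.Integer using (ℤ; +_; _+_; _*_; _-_; -_)
open import Data.Integer.Properties using (+-identityʳ)
open import Data.Integer.Divisibility.Signed using (_∣_; divides; ∣⇒∣ᵤ; ∣m⇒∣-m; ∣m∣n⇒∣m+n)
open import Data.Integer.Tactic.RingSolver using (solve)
open import Data.List using (List; []; _∷_)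
open import Data.Product using (_×_; _,_; proj₁; proj₂)
open import Data.Sum using (_⊎_; inj₁; inj₂)
open import Data.Empty using (⊥-elim)
open import Function using (_∘_)
open import Relation.Binary.PropositionalEquality
  using (_≡_; refl; sym; trans; cong; cong₂; subst; module ≡-Reasoning)
open import Relation.Binary.Construct.Closure.ReflexiveTransitive using (Star; fold; gmap)
open import Relation.Nullary using (¬_)

open ≡-Reasoning

infix 4 _≡_mod_

-- A record rather than a synonym for m ∣ a - b, so that a and b stay inferable.
record _≡_mod_ (a b m : ℤ) : Set where
  constructor congruent
  field divides-difference : m ∣ a - b

≡mod-refl : ∀ {m a} → a ≡ a mod m
≡mod-refl {m} {a} = congruent (divides (+ 0) (solve (a ∷ m ∷ [])))

≡mod-trans : ∀ {m a b c} → a ≡ b mod m → b ≡ c mod m → a ≡ c mod m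
≡mod-trans {m} {a} {b} {c} (congruent p) (congruent q) =
  congruent (subst (m ∣_) telescope (∣m∣n⇒∣m+n p q))
  where
  telescope : (a - b) + (b - c) ≡ a - c
  telescope = solve (a ∷ b ∷ c ∷ [])

≡⇒≡mod : ∀ {m a b} → a ≡ b → a ≡ b mod m
≡⇒≡mod refl = ≡mod-refl

4∤2 : ¬ (+ 4 ∣ + 2)
4∤2 p with ∣⇒≤ (∣⇒∣ᵤ p)
... | s≤s (s≤s ())

4k+1≢4k+3 : ∀ k → ¬ (+ 4 * k + + 1 ≡ + 4 * k + + 3 mod + 4)
4k+1≢4k+3 k (congruent 4∣d) = 4∤2 (∣m⇒∣-m (subst (+ 4 ∣_) difference 4∣d))
  where
  difference : (+ 4 * k + + 1) - (+ 4 * k + + 3) ≡ - + 2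
  difference = solve (k ∷ [])

-[4k+1]≢-[4k+3] : ∀ k → ¬ (- (+ 4 * k + + 1) ≡ - (+ 4 * k + + 3) mod + 4)
-[4k+1]≢-[4k+3] k (congruent 4∣d) = 4∤2 (subst (+ 4 ∣_) difference 4∣d)
  where
  difference : - (+ 4 * k + + 1) - - (+ 4 * k + + 3) ≡ + 2
  difference = solve (k ∷ [])

infixl 6 _⊕_

_⊕_ : ℤ × ℤ → ℤ × ℤ → ℤ × ℤ
(x , y) ⊕ (u , w) = (x + u , y + w)

minkowski : ℤ × ℤ → ℤ × ℤ → ℤ
minkowski (x , y) (u , w) = y * w - x * u

Lightlike : ℤ × ℤ → Set
Lightlike v = minkowski v v ≡ + 0

minkowski-⊕-lightlike : ∀ m v → Lightlike v → minkowski (m ⊕ v) v ≡ minkowski m v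
minkowski-⊕-lightlike (x , y) (u , w) null = begin
  (y + w) * w - (x + u) * u          ≡⟨ solve (x ∷ y ∷ u ∷ w ∷ []) ⟩
  (y * w - x * u) + (w * w - u * u)  ≡⟨ cong (λ s → y * w - x * u + s) null ⟩
  (y * w - x * u) + + 0              ≡⟨ +-identityʳ _ ⟩
  y * w - x * u                      ∎

velocity : Dir → ℤ × ℤ
velocity NE = (+ 1 , + 1)
velocity NW = (- + 1 , + 1)
velocity SE = (+ 1 , - + 1)
velocity SW = (- + 1 , - + 1)

velocity-lightlike : ∀ d → Lightlike (velocity d)
velocity-lightlike NE = refl
velocity-lightlike NW = refl
velocity-lightlike SE = refl
velocity-lightlike SW = refl

signedIntercept : Edge × Dir → ℤ
signedIntercept (e , d) = minkowski (mid e) (velocity d)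

2[i+1]≡2i+1+1 : ∀ i → + 2 * (i + + 1) ≡ + 2 * i + + 1 + + 1
2[i+1]≡2i+1+1 i = solve (i ∷ [])

2i≡2i+1-1 : ∀ i → + 2 * i ≡ + 2 * i + + 1 + - + 1
2i≡2i+1-1 i = solve (i ∷ [])

2[i-1]+1≡2i-1 : ∀ i → + 2 * (i - + 1) + + 1 ≡ + 2 * i + - + 1
2[i-1]+1≡2i-1 i = solve (i ∷ [])

mid-adv : ∀ e d → mid (adv e d) ≡ mid e ⊕ velocity d
mid-adv (horiz i j) NE = cong₂ _,_ (2[i+1]≡2i+1+1 i) refl
mid-adv (horiz i j) NW = cong₂ _,_ (2i≡2i+1-1 i) refl
mid-adv (horiz i j) SE = cong₂ _,_ (2[i+1]≡2i+1+1 i) (2[i-1]+1≡2i-1 j)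
mid-adv (horiz i j) SW = cong₂ _,_ (2i≡2i+1-1 i) (2[i-1]+1≡2i-1 j)
mid-adv (vert i j)  NE = cong₂ _,_ refl (2[i+1]≡2i+1+1 j)
mid-adv (vert i j)  NW = cong₂ _,_ (2[i-1]+1≡2i-1 i) (2[i+1]≡2i+1+1 j)
mid-adv (vert i j)  SE = cong₂ _,_ refl (2i≡2i+1-1 j)
mid-adv (vert i j)  SW = cong₂ _,_ (2[i-1]+1≡2i-1 i) (2i≡2i+1-1 j)

signedIntercept-adv : ∀ e d → signedIntercept (adv e d , d) ≡ signedIntercept (e , d)
signedIntercept-adv e d = begin
  minkowski (mid (adv e d)) (velocity d)      ≡⟨ cong (λ m → minkowski m (velocity d)) (mid-adv e d) ⟩
  minkowski (mid e ⊕ velocity d) (velocity d) ≡⟨ minkowski-⊕-lightlike (mid e) (velocity d) (velocity-lightlike d) ⟩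
  minkowski (mid e) (velocity d)              ∎

signedIntercept-Travel : ∀ {P Q e d e'} → Travel P Q e d e' → signedIntercept (e' , d) ≡ signedIntercept (e , d)
signedIntercept-Travel {e = e} {d} (hit _)    = signedIntercept-adv e d
signedIntercept-Travel {e = e} {d} (pass _ t) = trans (signedIntercept-Travel t) (signedIntercept-adv e d)

mirror : Edge → ℤ × ℤ → ℤ × ℤ
mirror (horiz _ _) (u , w) = (u , - w)
mirror (vert _ _)  (u , w) = (- u , w)

velocity-reflectDir : ∀ e d → velocity (reflectDir e d) ≡ mirror e (velocity d)
velocity-reflectDir (horiz _ _) NE = refl
velocity-reflectDir (horiz _ _) NW = refl
velocity-reflectDir (horiz _ _) SE = refl
velocity-reflectDir (horiz _ _) SW = refl
velocity-reflectDir (vert _ _)  NE = refl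
velocity-reflectDir (vert _ _)  NW = refl
velocity-reflectDir (vert _ _)  SE = refl
velocity-reflectDir (vert _ _)  SW = refl

minkowski-mirror : ∀ e v → minkowski (mid e) v ≡ minkowski (mid e) (mirror e v) mod + 4
minkowski-mirror (horiz i j) (u , w) = congruent (divides (j * w) (begin
  (+ 2 * j * w - (+ 2 * i + + 1) * u) - (+ 2 * j * - w - (+ 2 * i + + 1) * u) ≡⟨ solve (i ∷ j ∷ u ∷ w ∷ []) ⟩
  j * w * + 4                                                                ∎))
minkowski-mirror (vert i j) (u , w) = congruent (divides (- (i * u)) (begin
  ((+ 2 * j + + 1) * w - + 2 * i * u) - ((+ 2 * j + + 1) * w - + 2 * i * - u) ≡⟨ solve (i ∷ j ∷ u ∷ w ∷ []) ⟩
  - (i * u) * + 4                                                            ∎))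

signedIntercept-reflectDir : ∀ e d → signedIntercept (e , d) ≡ signedIntercept (e , reflectDir e d) mod + 4
signedIntercept-reflectDir e d rewrite velocity-reflectDir e d = minkowski-mirror e (velocity d)

signedIntercept-Next : ∀ {P Q x y} → Next P Q x y → signedIntercept x ≡ signedIntercept y mod + 4
signedIntercept-Next {y = e' , _} (travel , refl) =
  ≡mod-trans (≡⇒≡mod (sym (signedIntercept-Travel travel))) (signedIntercept-reflectDir e' _)

signedIntercept-Star : ∀ {P Q x y} → Star (Next P Q) x y → signedIntercept x ≡ signedIntercept y mod + 4
signedIntercept-Star = fold (_≡_mod + 4) ≡mod-trans ≡mod-refl ∘ gmap signedIntercept signedIntercept-Next

Oriented : Dir → Dir → Dir → ℤ → ℤ → Set
Oriented a b d s c = (d ≡ a × s ≡ c) ⊎ (d ≡ b × s ≡ - c)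

diagonal⇒Oriented : ∀ m {d c} → (d ≡ NE ⊎ d ≡ SW) × proj₂ m - proj₁ m ≡ c →
  Oriented NE SW d (minkowski m (velocity d)) c
diagonal⇒Oriented (x , y) (inj₁ refl , refl) = inj₁ (refl , (begin
  y * + 1 - x * + 1 ≡⟨ solve (x ∷ y ∷ []) ⟩ y - x ∎))
diagonal⇒Oriented (x , y) (inj₂ refl , refl) = inj₂ (refl , (begin
  y * - + 1 - x * - + 1 ≡⟨ solve (x ∷ y ∷ []) ⟩ - (y - x) ∎))

antidiagonal⇒Oriented : ∀ m {d c} → (d ≡ NW ⊎ d ≡ SE) × proj₂ m + proj₁ m ≡ c →
  Oriented NW SE d (minkowski m (velocity d)) c
antidiagonal⇒Oriented (x , y) (inj₁ refl , refl) = inj₁ (refl , (begin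
  y * + 1 - x * - + 1 ≡⟨ solve (x ∷ y ∷ []) ⟩ y + x ∎))
antidiagonal⇒Oriented (x , y) (inj₂ refl , refl) = inj₂ (refl , (begin
  y * - + 1 - x * + 1 ≡⟨ solve (x ∷ y ∷ []) ⟩ - (y + x) ∎))

onDiagLine⇒Oriented : ∀ e {d c} → OnDiagLine e d c → Oriented NE SW d (signedIntercept (e , d)) c
onDiagLine⇒Oriented e@(horiz _ _) = diagonal⇒Oriented (mid e)
onDiagLine⇒Oriented e@(vert _ _)  = diagonal⇒Oriented (mid e)

onAntiLine⇒Oriented : ∀ e {d c} → OnAntiLine e d c → Oriented NW SE d (signedIntercept (e , d)) c
onAntiLine⇒Oriented e@(horiz _ _) = antidiagonal⇒Oriented (mid e)
onAntiLine⇒Oriented e@(vert _ _)  = antidiagonal⇒Oriented (mid e)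

oppositeDirections : ∀ {a b d₁ d₂ s₁ s₂} k → s₁ ≡ s₂ mod + 4 →
  Oriented a b d₁ s₁ (+ 4 * k + + 1) → Oriented a b d₂ s₂ (+ 4 * k + + 3) →
  (d₁ ≡ a × d₂ ≡ b) ⊎ (d₁ ≡ b × d₂ ≡ a)
oppositeDirections k s₁≡s₂ (inj₁ (refl , refl)) (inj₁ (refl , refl)) = ⊥-elim (4k+1≢4k+3 k s₁≡s₂)
oppositeDirections _ _     (inj₁ (refl , _))    (inj₂ (refl , _))    = inj₁ (refl , refl)
oppositeDirections _ _     (inj₂ (refl , _))    (inj₁ (refl , _))    = inj₂ (refl , refl)
oppositeDirections k s₁≡s₂ (inj₂ (refl , refl)) (inj₂ (refl , refl)) = ⊥-elim (-[4k+1]≢-[4k+3] k s₁≡s₂)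

lemma3p1 : (n : ℕ) (P Q : List Step) → Dyck n P → Dyck n Q →
  (e₁ : Edge) (d₁ : Dir) (e₂ : Edge) (d₂ : Dir) →
  Emits P Q e₁ d₁ →
  Star (Next P Q) (e₁ , d₁) (e₂ , d₂) →
  ((k : ℤ) → OnDiagLine e₁ d₁ (+ 4 * k + + 1) → OnDiagLine e₂ d₂ (+ 4 * k + + 3) →
    (d₁ ≡ NE × d₂ ≡ SW) ⊎ (d₁ ≡ SW × d₂ ≡ NE))
  ×
  ((k : ℤ) → OnAntiLine e₁ d₁ (+ 4 * k + + 1) → OnAntiLine e₂ d₂ (+ 4 * k + + 3) →
    (d₁ ≡ NW × d₂ ≡ SE) ⊎ (d₁ ≡ SE × d₂ ≡ NW))
lemma3p1 _ _ _ _ _ e₁ d₁ e₂ d₂ _ trajectory =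
    (λ k on₁ on₂ → oppositeDirections k invariant (onDiagLine⇒Oriented e₁ on₁) (onDiagLine⇒Oriented e₂ on₂))
  , (λ k on₁ on₂ → oppositeDirections k invariant (onAntiLine⇒Oriented e₁ on₁) (onAntiLine⇒Oriented e₂ on₂))
  where
  invariant : signedIntercept (e₁ , d₁) ≡ signedIntercept (e₂ , d₂) mod + 4
  invariant = signedIntercept-Star trajectory
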